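{- Let $n=p_1^{\alpha_1}p_2^{\alpha_2}\cdots p_r^{\alpha_r}$ where $r\ge 2$, $p_1<p_2<\cdots<p_r$ are primes and $\alpha_i\in\mathbb{N}$. Let $$\eta_1(n)=\frac{n}{p_r^{\alpha_r}}+(p_r^{\alpha_r}-1)\phi\!\left(\frac{n}{p_r^{\alpha_r}}\right)-1,\qquad \eta_2(n)=\frac{n}{p_{r-1}p_r}+\phi(n)+\phi\!\left(\frac{n}{p_r}\right)+\phi\!\left(\frac{n}{p_{r-1}}\right)-1.$$ Then $\delta(\mathcal{G}(\mathbb{Z}_n))\le\eta_1(n)$ and $\delta(\mathcal{G}(\mathbb{Z}_n))\le\eta_2(n)$, and both upper bounds are sharp (each is attained with equality for some such $n$).
   Context: $\mathbb{Z}_n$ is the additive group of integers modulo $n$; $\phi$ is Euler's phi function. The power graph $\mathcal{G}(G)$ of a group $G$ has vertex set $G$, distinct $u,v$ adjacent iff one is a positive integer power (multiple) of the other. $\delta$ denotes minimum degree. -}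

module Defs where

open import Data.Nat using (ℕ; zero; suc; _+_; _*_; _∸_; _^_; _≤_; _<_; _⊓_; _≡ᵇ_; _%_; _/_)
open import Data.Nat.GCD using (gcd)
open import Data.Nat.Divisibility using (_∣_)
open import Data.Nat.Primality using (Prime)
open import Data.Bool using (Bool; not; _∧_; _∨_)
open import Data.List using (List; upTo; map; length; filterᵇ; foldr)
open import Data.Bool.ListAction using (any)
open import Relation.Nullary using (¬_)

-- residue of x modulo n (n = 0 unused; returns 0)
_mod_ : ℕ → ℕ → ℕ
x mod zero = zero
x mod suc n = x % suc n

-- quotient (d = 0 unused; returns 0)
_div_ : ℕ → ℕ → ℕ
x div zero = zero
x div suc d = x / suc d

φ : ℕ → ℕ
φ n = length (filterᵇ (λ k → gcd k n ≡ᵇ 1) (map suc (upTo n)))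

-- In ℤ_n (elements 0,…,n-1): u is a positive multiple of v,
-- i.e. u = k·v in ℤ_n for some k ≥ 1.  Since k·v depends only on
-- k mod n, it suffices to let k range over 1,…,n.
isMultiple : ℕ → ℕ → ℕ → Bool
isMultiple n u v = any (λ j → ((suc j * v) mod n) ≡ᵇ u) (upTo n)

adjacent : ℕ → ℕ → ℕ → Bool
adjacent n u v = not (u ≡ᵇ v) ∧ (isMultiple n u v ∨ isMultiple n v u)

degree : ℕ → ℕ → ℕ
degree n v = length (filterᵇ (λ u → adjacent n u v) (upTo n))

-- minimum degree δ(𝒢(ℤ_n)) (n ≥ 1; value 0 for the empty graph n = 0)
minDegree : ℕ → ℕ
minDegree zero = zero
minDegree (suc m) = foldr _⊓_ (degree (suc m) 0) (map (degree (suc m)) (upTo (suc m)))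

-- n = p₁^α₁ ⋯ p_r^α_r with r ≥ 2, p₁ < ⋯ < p_r, α_i ≥ 1;
-- q = p_r (largest prime divisor), a = α_r (its exact exponent),
-- p = p_{r-1} (largest prime divisor below q).
record Shape (n p q a : ℕ) : Set where
  field
    n-pos       : 0 < n
    p-prime     : Prime p
    q-prime     : Prime q
    p<q         : p < q
    p∣n         : p ∣ n
    a-pos       : 1 ≤ a
    qᵃ∣n        : q ^ a ∣ n
    qᵃ⁺¹∤n      : ¬ (q ^ suc a ∣ n)
    q-largest   : ∀ d → Prime d → d ∣ n → d ≤ q
    p-next      : ∀ d → Prime d → d ∣ n → d < q → d ≤ p

η₁ : ℕ → ℕ → ℕ → ℕ
η₁ n q a = n div (q ^ a) + (q ^ a ∸ 1) * φ (n div (q ^ a)) ∸ 1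

η₂ : ℕ → ℕ → ℕ → ℕ
η₂ n p q = n div (p * q) + φ n + φ (n div q) + φ (n div p) ∸ 1

module Submission where

-- In ℤ_n the element u is a positive multiple of v iff gcd(v,n) ∣ u.  So u ~ v in 𝒢(ℤ_n)
-- iff u ≠ v and (gcd(v,n) ∣ u or gcd(u,n) ∣ v).  Write n = k·g with g = gcd(v,n) (every
-- divisor g of n arises this way).  The neighbours of v are then the k − 1 other multiples
-- of g, together with some of the u "above g": g ∤ u but gcd(u,n) ∣ g.  Hence
--     δ(𝒢(ℤ_n)) ≤ (k − 1) + #{u above g}.
-- For g = q^α (unitary, gcd(g,k) = 1) every u above g is coprime to k and not a multiple
-- of g; there are g·φ(k) − φ(k) such u, which gives η₁.  For g = p·q every u above g is a
-- unit, or q·t with gcd(t, n/q) = 1, or p·t with gcd(t, n/p) = 1, which gives η₂.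
--
-- Sharpness is
-- checked by evaluation (n = 6 for η₁, n = 210 for η₂), using the gcd description of
-- degrees, which is fast to evaluate.

open import Defs
open import Algebra.Properties.CommutativeSemigroup using (interchange)
open import Data.Bool using (Bool; true; false; not; T)
open import Data.Bool.Properties using (T-∧; T-∨)
open import Data.List using (List; _∷_; upTo; applyUpTo; map; foldr; length; filterᵇ)
open import Data.List.Membership.Propositional using (_∈_; lose)
open import Data.List.Membership.Propositional.Properties using (∈-upTo⁺; ∈-upTo⁻)
open import Data.List.Properties using (map-upTo; map-cong-local)
open import Data.List.Relation.Unary.All using (tabulate)
open import Data.List.Relation.Unary.Any using (here; there; satisfied)
open import Data.List.Relation.Unary.Any.Properties using (any⁺; any⁻)
open import Data.Nat
import Data.Nat.Coprimality as Coprimality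
open import Data.Nat.Coprimality using (Coprime; coprime?; coprime-divisor; coprime⇒gcd≡1; gcd≡1⇒coprime)
open import Data.Nat.Divisibility
open import Data.Nat.DivMod using (_%_; _/_; %-distribˡ-*; [m+kn]%n≡m%n; m<n⇒m%n≡m; n%n≡0; m%n<n; m*n/n≡m; m/n*n≡m)
open import Data.Nat.GCD using (gcd; gcd-GCD; gcd[m,n]∣m; gcd[m,n]∣n; gcd-greatest; module Bézout)
open import Data.Nat.Primality using (Prime; prime?; prime⇒irreducible; prime⇒nonZero; ¬prime[1])
open import Data.Nat.Properties
open import Data.Nat.Tactic.RingSolver using (solve-∀)
open import Data.Product using (_×_; _,_; proj₂; ∃-syntax)
import Data.Product as Product
open import Data.Product.Function.NonDependent.Propositional using (_×-⇔_)
open import Data.Sum using (_⊎_; inj₁; inj₂)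
open import Data.Sum.Function.Propositional using (_⊎-⇔_)
open import Data.Unit using (tt)
open import Function using (_∘_; id)
open import Function.Bundles using (_⇔_; mk⇔; Equivalence)
open import Function.Construct.Composition using (_⇔-∘_)
open import Level using (0ℓ)
open import Relation.Binary.PropositionalEquality
open import Relation.Nullary using (Dec; yes; no; ¬_; ¬?; _×-dec_; _⊎-dec_; contradiction)
open import Relation.Nullary.Decidable using (T?; True; toWitness; from-yes; from-no; _→-dec_)
open import Relation.Unary using (Pred; Decidable)
open import Relation.Unary.Properties using (∁?; _∩?_; _∪?_)

open ≤-Reasoning

private variable
  A B : Set
  P Q : Pred ℕ 0ℓ

indicator : Dec A → ℕ
indicator (yes _) = 1
indicator (no _)  = 0

indicator-mono : (A → B) → (a : Dec A) (b : Dec B) → indicator a ≤ indicator b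
indicator-mono f (yes a) (yes _) = ≤-refl
indicator-mono f (yes a) (no ¬b) = contradiction (f a) ¬b
indicator-mono f (no _)  _       = z≤n

indicator-cong : A ⇔ B → (a : Dec A) (b : Dec B) → indicator a ≡ indicator b
indicator-cong A⇔B a b =
  ≤-antisym (indicator-mono (Equivalence.to A⇔B) a b) (indicator-mono (Equivalence.from A⇔B) b a)

+-interchange : ∀ a b c d → (a + b) + (c + d) ≡ (a + c) + (b + d)
+-interchange = interchange +-commutativeSemigroup

count : Decidable P → ℕ → ℕ
count P? zero    = 0
count P? (suc N) = indicator (P? 0) + count (P? ∘ suc) N

length-filterᵇ : (f : ℕ → Bool) (g : ℕ → ℕ) (N : ℕ) →
                 length (filterᵇ f (applyUpTo g N)) ≡ count (λ u → T? (f (g u))) N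
length-filterᵇ f g zero = refl
length-filterᵇ f g (suc N) with f (g 0)
... | true  = cong suc (length-filterᵇ f (g ∘ suc) N)
... | false = length-filterᵇ f (g ∘ suc) N

count-mono : (P? : Decidable P) (Q? : Decidable Q) (N : ℕ) →
             (∀ {u} → u < N → P u → Q u) → count P? N ≤ count Q? N
count-mono P? Q? zero    _   = z≤n
count-mono P? Q? (suc N) P⇒Q =
  +-mono-≤ (indicator-mono (P⇒Q z<s) (P? 0) (Q? 0))
           (count-mono (P? ∘ suc) (Q? ∘ suc) N (P⇒Q ∘ s<s))

count-cong : (P? : Decidable P) (Q? : Decidable Q) (N : ℕ) →
             (∀ {u} → u < N → P u ⇔ Q u) → count P? N ≡ count Q? N
count-cong P? Q? N P⇔Q = ≤-antisym
  (count-mono P? Q? N (λ u<N → Equivalence.to (P⇔Q u<N)))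
  (count-mono Q? P? N (λ u<N → Equivalence.from (P⇔Q u<N)))

count-∪ : (P? : Decidable P) (Q? : Decidable Q) (N : ℕ) →
          count (P? ∪? Q?) N ≤ count P? N + count Q? N
count-∪ P? Q? zero    = z≤n
count-∪ P? Q? (suc N) = begin
    indicator (P? 0 ⊎-dec Q? 0) + count ((P? ∪? Q?) ∘ suc) N
  ≤⟨ +-mono-≤ (indicator-⊎ (P? 0) (Q? 0)) (count-∪ (P? ∘ suc) (Q? ∘ suc) N) ⟩
    (indicator (P? 0) + indicator (Q? 0)) + (count (P? ∘ suc) N + count (Q? ∘ suc) N)
  ≡⟨ +-interchange (indicator (P? 0)) (indicator (Q? 0)) (count (P? ∘ suc) N) _ ⟩
    count P? (suc N) + count Q? (suc N) ∎
  where
  indicator-⊎ : (a : Dec A) (b : Dec B) → indicator (a ⊎-dec b) ≤ indicator a + indicator b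
  indicator-⊎ (yes _) _       = s≤s z≤n
  indicator-⊎ (no _)  (yes _) = ≤-refl
  indicator-⊎ (no _)  (no _)  = z≤n

count-∁ : (P? : Decidable P) (N : ℕ) → count P? N + count (∁? P?) N ≡ N
count-∁ P? zero    = refl
count-∁ P? (suc N) = begin-equality
    (indicator (P? 0) + count (P? ∘ suc) N) + (indicator (¬? (P? 0)) + count (∁? P? ∘ suc) N)
  ≡⟨ +-interchange (indicator (P? 0)) (count (P? ∘ suc) N) (indicator (¬? (P? 0))) _ ⟩
    (indicator (P? 0) + indicator (¬? (P? 0))) + (count (P? ∘ suc) N + count (∁? P? ∘ suc) N)
  ≡⟨ cong₂ _+_ (indicator-¬ (P? 0)) (count-∁ (P? ∘ suc) N) ⟩
    suc N ∎
  where
  indicator-¬ : (a : Dec A) → indicator a + indicator (¬? a) ≡ 1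
  indicator-¬ (yes _) = refl
  indicator-¬ (no _)  = refl

count-split : (Q? : Decidable Q) (P? : Decidable P) (N : ℕ) →
              count P? N ≡ count (Q? ∩? P?) N + count (∁? Q? ∩? P?) N
count-split Q? P? zero    = refl
count-split Q? P? (suc N) = begin-equality
    indicator (P? 0) + count (P? ∘ suc) N
  ≡⟨ cong₂ _+_ (indicator-split (Q? 0) (P? 0)) (count-split (Q? ∘ suc) (P? ∘ suc) N) ⟩
    (indicator (Q? 0 ×-dec P? 0) + indicator (¬? (Q? 0) ×-dec P? 0))
      + (count ((Q? ∩? P?) ∘ suc) N + count ((∁? Q? ∩? P?) ∘ suc) N)
  ≡⟨ +-interchange (indicator (Q? 0 ×-dec P? 0)) (indicator (¬? (Q? 0) ×-dec P? 0))
                   (count ((Q? ∩? P?) ∘ suc) N) _ ⟩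
    count (Q? ∩? P?) (suc N) + count (∁? Q? ∩? P?) (suc N) ∎
  where
  indicator-split : (b : Dec B) (a : Dec A) → indicator a ≡ indicator (b ×-dec a) + indicator (¬? b ×-dec a)
  indicator-split (yes _) (yes _) = refl
  indicator-split (no _)  (yes _) = refl
  indicator-split (yes _) (no _)  = refl
  indicator-split (no _)  (no _)  = refl

count-+ : (P? : Decidable P) (a b : ℕ) → count P? (a + b) ≡ count P? a + count (λ u → P? (a + u)) b
count-+ P? zero    b = refl
count-+ P? (suc a) b =
  trans (cong (indicator (P? 0) +_) (count-+ (P? ∘ suc) a b))
        (sym (+-assoc (indicator (P? 0)) (count (P? ∘ suc) a) _))

count-snoc : (P? : Decidable P) (N : ℕ) → count P? (suc N) ≡ count P? N + indicator (P? N)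
count-snoc P? zero    = +-comm (indicator (P? 0)) 0
count-snoc P? (suc N) =
  trans (cong (indicator (P? 0) +_) (count-snoc (P? ∘ suc) N))
        (sym (+-assoc (indicator (P? 0)) (count (P? ∘ suc) N) _))

count-pos : (P? : Decidable P) {N u : ℕ} → u < N → P u → 1 ≤ count P? N
count-pos P? {suc N} {zero} _ p0 with P? 0
... | yes _   = s≤s z≤n
... | no ¬p0  = contradiction p0 ¬p0
count-pos P? {suc N} {suc u} u<N pu =
  ≤-trans (count-pos (P? ∘ suc) (s<s⁻¹ u<N) pu) (m≤n+m _ _)

count-none : (P? : Decidable P) (N : ℕ) → (∀ {u} → u < N → ¬ P u) → count P? N ≡ 0
count-none P? zero    _    = refl
count-none P? (suc N) none with P? 0
... | yes p0 = contradiction p0 (none z<s)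
... | no _   = count-none (P? ∘ suc) N (none ∘ s<s)

count-rotate : (P? : Decidable P) (m : ℕ) → P 0 ⇔ P m → count (P? ∘ suc) m ≡ count P? m
count-rotate P? m P0⇔Pm = +-cancelʳ-≡ (indicator (P? m)) _ _ (begin-equality
    count (P? ∘ suc) m + indicator (P? m)
  ≡⟨ cong (count (P? ∘ suc) m +_) (indicator-cong P0⇔Pm (P? 0) (P? m)) ⟨
    count (P? ∘ suc) m + indicator (P? 0)
  ≡⟨ +-comm _ (indicator (P? 0)) ⟩
    count P? (suc m)
  ≡⟨ count-snoc P? m ⟩
    count P? m + indicator (P? m) ∎)

count-periodic : (P? : Decidable P) (m k : ℕ) → (∀ u → P (m + u) ⇔ P u) →
                 count P? (k * m) ≡ k * count P? m
count-periodic P? m zero    _   = refl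
count-periodic P? m (suc k) per = begin-equality
    count P? (m + k * m)
  ≡⟨ count-+ P? m (k * m) ⟩
    count P? m + count (λ u → P? (m + u)) (k * m)
  ≡⟨ cong (count P? m +_) (count-cong _ P? (k * m) (λ {u} _ → per u)) ⟩
    count P? m + count P? (k * m)
  ≡⟨ cong (count P? m +_) (count-periodic P? m k per) ⟩
    count P? m + k * count P? m ∎

count-multiples-below : (P? : Decidable P) (G : ℕ) .{{_ : NonZero G}} →
                        count ((G ∣?_) ∩? P?) G ≡ indicator (P? 0)
count-multiples-below P? (suc g) = begin-equality
    indicator (suc g ∣? 0 ×-dec P? 0) + count (((suc g ∣?_) ∩? P?) ∘ suc) g
  ≡⟨ cong₂ _+_ (indicator-cong (mk⇔ proj₂ (suc g ∣0 ,_)) _ (P? 0))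
               (count-none _ g (λ u<g (G∣u , _) → >⇒∤ (s<s u<g) G∣u)) ⟩
    indicator (P? 0) + 0
  ≡⟨ +-identityʳ _ ⟩
    indicator (P? 0) ∎

count-multiples : (P? : Decidable P) (G k : ℕ) .{{_ : NonZero G}} →
                  count ((G ∣?_) ∩? P?) (k * G) ≡ count (λ t → P? (t * G)) k
count-multiples P? G zero    = refl
count-multiples P? G (suc k) = begin-equality
    count ((G ∣?_) ∩? P?) (G + k * G)
  ≡⟨ count-+ ((G ∣?_) ∩? P?) G (k * G) ⟩
    count ((G ∣?_) ∩? P?) G + count (λ u → (G ∣? (G + u)) ×-dec P? (G + u)) (k * G)
  ≡⟨ cong₂ _+_ (count-multiples-below P? G)
               (count-cong _ ((G ∣?_) ∩? (λ u → P? (G + u))) (k * G) (λ _ → shift)) ⟩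
    indicator (P? 0) + count ((G ∣?_) ∩? (λ u → P? (G + u))) (k * G)
  ≡⟨ cong (indicator (P? 0) +_) (count-multiples (λ u → P? (G + u)) G k) ⟩
    indicator (P? 0) + count (λ t → P? (G + t * G)) k ∎
  where
  shift : ∀ {u} {X : Set} → (G ∣ G + u × X) ⇔ (G ∣ u × X)
  shift = mk⇔ (Product.map₁ (λ d → ∣m+n∣m⇒∣n d ∣-refl)) (Product.map₁ (∣m∣n⇒∣m+n ∣-refl))

φ-count : (m : ℕ) → φ m ≡ count (λ u → coprime? u m) m
φ-count m = begin-equality
    length (filterᵇ (λ k → gcd k m ≡ᵇ 1) (map suc (upTo m)))
  ≡⟨ cong (length ∘ filterᵇ (λ k → gcd k m ≡ᵇ 1)) (map-upTo suc m) ⟩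
    length (filterᵇ (λ k → gcd k m ≡ᵇ 1) (applyUpTo suc m))
  ≡⟨ length-filterᵇ _ suc m ⟩
    count (λ u → T? (gcd (suc u) m ≡ᵇ 1)) m
  ≡⟨ count-cong _ _ m (λ _ → T-gcd≡ᵇ1) ⟩
    count (λ u → coprime? (suc u) m) m
  ≡⟨ count-rotate (λ u → coprime? u m) m (mk⇔ 0⊥m⇒m⊥m m⊥m⇒0⊥m) ⟩
    count (λ u → coprime? u m) m ∎
  where
  T-gcd≡ᵇ1 : ∀ {k} → T (gcd k m ≡ᵇ 1) ⇔ Coprime k m
  T-gcd≡ᵇ1 = mk⇔ (gcd≡1⇒coprime ∘ ≡ᵇ⇒≡ _ 1) (≡⇒≡ᵇ _ 1 ∘ coprime⇒gcd≡1)
  0⊥m⇒m⊥m : Coprime 0 m → Coprime m m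
  0⊥m⇒m⊥m c (_ , i∣m) = c (_ ∣0 , i∣m)
  m⊥m⇒0⊥m : Coprime m m → Coprime 0 m
  m⊥m⇒0⊥m c (_ , i∣m) = c (i∣m , i∣m)

prime∤⇒coprime : ∀ {q m} → Prime q → ¬ q ∣ m → Coprime q m
prime∤⇒coprime pq q∤m (i∣q , i∣m) with prime⇒irreducible pq i∣q
... | inj₁ i≡1    = i≡1
... | inj₂ refl   = contradiction i∣m q∤m

coprime-* : ∀ {x y m} → Coprime x m → Coprime y m → Coprime (x * y) m
coprime-* {x} x⊥m y⊥m {i} (i∣xy , i∣m) = y⊥m (coprime-divisor i⊥x i∣xy , i∣m)
  where
  i⊥x : Coprime i x
  i⊥x (j∣i , j∣x) = x⊥m (j∣x , ∣-trans j∣i i∣m)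

coprime-^ : ∀ {q m} a → Coprime q m → Coprime (q ^ a) m
coprime-^ zero    _   (i∣1 , _) = ∣1⇒≡1 i∣1
coprime-^ (suc a) q⊥m = coprime-* q⊥m (coprime-^ a q⊥m)

coprime-*ʳ : ∀ {G m t} → Coprime G m → Coprime (t * G) m ⇔ Coprime t m
coprime-*ʳ {G} {m} {t} G⊥m = mk⇔ to from
  where
  to : Coprime (t * G) m → Coprime t m
  to tG⊥m (i∣t , i∣m) = tG⊥m (∣m⇒∣m*n G i∣t , i∣m)
  from : Coprime t m → Coprime (t * G) m
  from t⊥m = coprime-* t⊥m G⊥m

coprime-∣-* : ∀ {P Q u} → Coprime P Q → P ∣ u → Q ∣ u → P * Q ∣ u
coprime-∣-* {P} {Q} P⊥Q P∣u (divides c refl)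
  with coprime-divisor P⊥Q (subst (P ∣_) (*-comm c Q) P∣u)
... | divides d refl = divides d (*-assoc d P Q)

distinct-primes-coprime : ∀ {P Q} → Prime P → Prime Q → P ≢ Q → Coprime P Q
distinct-primes-coprime {P} {Q} pP pQ P≢Q = prime∤⇒coprime pP P∤Q
  where
  P∤Q : ¬ P ∣ Q
  P∤Q P∣Q with prime⇒irreducible pQ P∣Q
  ... | inj₁ refl = ¬prime[1] pP
  ... | inj₂ P≡Q  = P≢Q P≡Q

div-exact : ∀ {n m d} .{{_ : NonZero d}} → n ≡ m * d → n div d ≡ m
div-exact {d = suc d} refl = m*n/n≡m _ (suc d)

%-cong-* : ∀ {a b} v n .{{_ : NonZero n}} → a % n ≡ b % n → (a * v) % n ≡ (b * v) % n
%-cong-* {a} {b} v n a≡b = begin-equality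
    (a * v) % n                ≡⟨ %-distribˡ-* a v n ⟩
    ((a % n) * (v % n)) % n    ≡⟨ cong (λ x → (x * (v % n)) % n) a≡b ⟩
    ((b % n) * (v % n)) % n    ≡⟨ %-distribˡ-* b v n ⟨
    (b * v) % n                ∎

positive-representative : ∀ K n → ∃[ j ] j < suc n × suc j % suc n ≡ K % suc n
positive-representative K n with K % suc n | m%n<n K (suc n)
... | zero  | _     = n , ≤-refl , n%n≡0 (suc n)
... | suc j | j<n   = j , m<n⇒m<1+n (s<s⁻¹ j<n) , m<n⇒m%n≡m j<n

gcd∣⇒solvable : ∀ u v n → gcd v (suc n) ∣ u → ∃[ K ] (K * v) % suc n ≡ u % suc n
gcd∣⇒solvable _ v n (divides c refl) with Bézout.identity (gcd-GCD v (suc n))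
... | Bézout.+- x y eq = c * x , (begin-equality
    (c * x * v) % N
  ≡⟨ cong (_% N) (trans (*-assoc c x v) (cong (c *_) (sym eq))) ⟩
    (c * (d + y * N)) % N
  ≡⟨ cong (_% N) (distribute c d y N) ⟩
    (c * d + c * y * N) % N
  ≡⟨ [m+kn]%n≡m%n (c * d) (c * y) N ⟩
    (c * d) % N ∎)
  where
  N = suc n
  d = gcd v N
  distribute : ∀ c d y N → c * (d + y * N) ≡ c * d + c * y * N
  distribute = solve-∀
... | Bézout.-+ x y eq = c * x * n , (begin-equality
    (c * x * n * v) % N
  ≡⟨ [m+kn]%n≡m%n (c * x * n * v) (c * y) N ⟨
    (c * x * n * v + c * y * N) % N
  ≡⟨ cong (λ z → (c * x * n * v + z) % N) (trans (*-assoc c y N) (cong (c *_) (sym eq))) ⟩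
    (c * x * n * v + c * (d + x * v)) % N
  ≡⟨ cong (_% N) (regroup c d x v n) ⟩
    (c * d + c * x * v * N) % N
  ≡⟨ [m+kn]%n≡m%n (c * d) (c * x * v) N ⟩
    (c * d) % N ∎)
  where
  N = suc n
  d = gcd v N
  regroup : ∀ c d x v n → c * x * n * v + c * (d + x * v) ≡ c * d + c * x * v * suc n
  regroup = solve-∀

isMultiple⇔gcd∣ : ∀ {u v n} → u < suc n → T (isMultiple (suc n) u v) ⇔ gcd v (suc n) ∣ u
isMultiple⇔gcd∣ {u} {v} {n} u<N = mk⇔ to from
  where
  N = suc n
  to : T (isMultiple N u v) → gcd v N ∣ u
  to t =
    let (j , jv≡u) = satisfied (any⁻ _ (upTo N) t)
    in subst (gcd v N ∣_) (≡ᵇ⇒≡ _ _ jv≡u)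
          (%-presˡ-∣ (∣-trans (gcd[m,n]∣m v N) (n∣m*n (suc j))) (gcd[m,n]∣n v N))
  from : gcd v N ∣ u → T (isMultiple N u v)
  from g∣u =
    let (K , Kv≡u)      = gcd∣⇒solvable u v n g∣u
        (j , j<N , j≡K) = positive-representative K n
    in any⁺ _ (lose (∈-upTo⁺ j<N) (≡⇒≡ᵇ _ _ (begin-equality
      (suc j * v) % N  ≡⟨ %-cong-* {suc j} {K} v N j≡K ⟩
      (K * v) % N      ≡⟨ Kv≡u ⟩
      u % N            ≡⟨ m<n⇒m%n≡m u<N ⟩
      u                ∎)))

GcdAdjacent : ℕ → ℕ → Pred ℕ 0ℓ
GcdAdjacent n v u = u ≢ v × (gcd v n ∣ u ⊎ gcd u n ∣ v)

gcdAdjacent? : ∀ n v → Decidable (GcdAdjacent n v)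
gcdAdjacent? n v u = ¬? (u ≟ v) ×-dec (gcd v n ∣? u ⊎-dec gcd u n ∣? v)

gcdDegree : ℕ → ℕ → ℕ
gcdDegree n v = count (gcdAdjacent? n v) n

T-not-≡ᵇ : ∀ u v → T (not (u ≡ᵇ v)) ⇔ u ≢ v
T-not-≡ᵇ u v with u ≡ᵇ v in eq
... | true  = mk⇔ (λ ()) (λ u≢v → u≢v (≡ᵇ⇒≡ u v (subst T (sym eq) tt)))
... | false = mk⇔ (λ _ u≡v → subst T eq (≡⇒≡ᵇ u v u≡v)) (λ _ → tt)

adjacent⇔ : ∀ {n u v} → u < suc n → v < suc n → T (adjacent (suc n) u v) ⇔ GcdAdjacent (suc n) v u
adjacent⇔ {n} {u} {v} u<N v<N =
  (T-not-≡ᵇ u v ×-⇔ ((isMultiple⇔gcd∣ {u} {v} u<N ⊎-⇔ isMultiple⇔gcd∣ {v} {u} v<N) ⇔-∘ T-∨)) ⇔-∘ T-∧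

degree≡gcdDegree : ∀ {n v} → v < suc n → degree (suc n) v ≡ gcdDegree (suc n) v
degree≡gcdDegree {n} {v} v<N =
  trans (length-filterᵇ (λ u → adjacent (suc n) u v) id (suc n))
        (count-cong (λ u → T? (adjacent (suc n) u v)) (gcdAdjacent? (suc n) v) (suc n)
                    (λ u<N → adjacent⇔ u<N v<N))

foldr-⊓-≤ : (f : ℕ → ℕ) (z : ℕ) {xs : List ℕ} {x : ℕ} → x ∈ xs → foldr _⊓_ z (map f xs) ≤ f x
foldr-⊓-≤ f z {y ∷ _}  (here refl) = m⊓n≤m (f y) _
foldr-⊓-≤ f z {y ∷ xs} (there x∈xs) = ≤-trans (m⊓n≤n (f y) _) (foldr-⊓-≤ f z x∈xs)

minDegree≤gcdDegree : ∀ {n v} → v < suc n → minDegree (suc n) ≤ gcdDegree (suc n) v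
minDegree≤gcdDegree {n} {v} v<N = begin
  minDegree (suc n)       ≤⟨ foldr-⊓-≤ (degree (suc n)) _ (∈-upTo⁺ v<N) ⟩
  degree (suc n) v        ≡⟨ degree≡gcdDegree v<N ⟩
  gcdDegree (suc n) v     ∎

-- δ(𝒢(ℤ_n)) computed through the gcd description, which is fast to evaluate.
minDegree≡ : ∀ n .{{_ : NonZero n}} → minDegree n ≡ foldr _⊓_ (gcdDegree n 0) (map (gcdDegree n) (upTo n))
minDegree≡ (suc n) = cong₂ (foldr _⊓_) (degree≡gcdDegree {n} z<s)
  (map-cong-local {xs = upTo (suc n)} (tabulate (degree≡gcdDegree {n} ∘ ∈-upTo⁻)))

vertex-with-gcd : ∀ {g n} → g ∣ suc n → ∃[ v ] v < suc n × gcd v (suc n) ≡ g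
vertex-with-gcd {g} {n} g∣N with g <? suc n
... | yes g<N = g , g<N , ∣-antisym (gcd[m,n]∣m g (suc n)) (gcd-greatest ∣-refl g∣N)
... | no  g≮N = 0 , z<s , (begin-equality
    gcd 0 (suc n)   ≡⟨ ∣-antisym (gcd[m,n]∣n 0 (suc n)) (gcd-greatest (suc n ∣0) ∣-refl) ⟩
    suc n           ≡⟨ ≤∧≮⇒≡ (∣⇒≤ g∣N) g≮N ⟨
    g               ∎)

-- u lies above g in ℤ_n when g ∤ u but gcd(u,n) ∣ g, i.e. ⟨u⟩ ⊋ ⟨g⟩.
Above : ℕ → ℕ → Pred ℕ 0ℓ
Above n g u = ¬ g ∣ u × gcd u n ∣ g

above? : ∀ n g → Decidable (Above n g)
above? n g u = ¬? (g ∣? u) ×-dec (gcd u n ∣? g)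

OtherMultiple : ℕ → ℕ → Pred ℕ 0ℓ
OtherMultiple g v u = g ∣ u × u ≢ v

otherMultiple? : ∀ g v → Decidable (OtherMultiple g v)
otherMultiple? g v = (g ∣?_) ∩? (λ u → ¬? (u ≟ v))

gcdDegree-≤ : ∀ {n v g} → gcd v n ≡ g →
              gcdDegree n v ≤ count (otherMultiple? g v) n + count (above? n g) n
gcdDegree-≤ {n} {v} {g} refl = ≤-trans (count-mono _ (otherMultiple? g v ∪? above? n g) n classify)
                                       (count-∪ _ _ n)
  where
  classify : ∀ {u} → u < n → GcdAdjacent n v u → OtherMultiple g v u ⊎ Above n g u
  classify {u} _ (u≢v , divs) with g ∣? u | divs
  ... | yes g∣u | _              = inj₁ (g∣u , u≢v)
  ... | no  g∤u | inj₁ g∣u       = contradiction g∣u g∤u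
  ... | no  g∤u | inj₂ gcdu∣v    = inj₂ (g∤u , gcd-greatest gcdu∣v (gcd[m,n]∣n u n))

other-multiples : ∀ g k {v} .{{_ : NonZero g}} → g ∣ v → v < k * g →
                  count (otherMultiple? g v) (k * g) ≤ k ∸ 1
other-multiples g k {v} (divides c refl) v<kg = begin
    count (otherMultiple? g v) (k * g)
  ≡⟨ count-multiples (λ u → ¬? (u ≟ v)) g k ⟩
    count (∁? Hit?) k
  ≡⟨ m+n∸m≡n (count Hit? k) _ ⟨
    count Hit? k + count (∁? Hit?) k ∸ count Hit? k
  ≡⟨ cong (_∸ count Hit? k) (count-∁ Hit? k) ⟩
    k ∸ count Hit? k
  ≤⟨ ∸-monoʳ-≤ k (count-pos Hit? (*-cancelʳ-< _ c k v<kg) refl) ⟩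
    k ∸ 1 ∎
  where
  Hit? : Decidable (λ t → t * g ≡ v)
  Hit? t = t * g ≟ v

minDegree-≤-divisor : ∀ {n k g} → suc n ≡ k * g →
                      minDegree (suc n) ≤ (k ∸ 1) + count (above? (suc n) g) (suc n)
minDegree-≤-divisor {n} {k} {zero} N≡k*0 = contradiction (trans N≡k*0 (*-zeroʳ k)) λ ()
minDegree-≤-divisor {n} {k} {g@(suc _)} N≡kg
  with (v , v<N , gcd≡g) ← vertex-with-gcd {g} (divides k N≡kg) = begin
    minDegree (suc n)
  ≤⟨ minDegree≤gcdDegree v<N ⟩
    gcdDegree (suc n) v
  ≤⟨ gcdDegree-≤ {suc n} {v} gcd≡g ⟩
    count (otherMultiple? g v) (suc n) + count (above? (suc n) g) (suc n)
  ≤⟨ +-monoˡ-≤ (count (above? (suc n) g) (suc n)) others ⟩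
    (k ∸ 1) + count (above? (suc n) g) (suc n) ∎
  where
  g∣v : g ∣ v
  g∣v = subst (_∣ v) gcd≡g (gcd[m,n]∣m v (suc n))
  others : count (otherMultiple? g v) (suc n) ≤ k ∸ 1
  others = subst (λ N → count (otherMultiple? g v) N ≤ k ∸ 1) (sym N≡kg)
                 (other-multiples g k g∣v (subst (v <_) N≡kg v<N))

-- If n = m·G with gcd(G,m) = 1, the u above G are coprime to m and not multiples of G;
-- there are G·φ(m) − φ(m) of those.
count-above-unitary : ∀ {m G} .{{_ : NonZero G}} → Coprime G m →
                      count (above? (m * G) G) (m * G) ≤ G * φ m ∸ φ m
count-above-unitary {m} {G} G⊥m = begin
    count (above? n G) n
  ≤⟨ count-mono _ (∁? (G ∣?_) ∩? C?) n (λ _ → above⇒coprime) ⟩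
    count (∁? (G ∣?_) ∩? C?) n
  ≡⟨ m+n∸m≡n (count ((G ∣?_) ∩? C?) n) _ ⟨
    count ((G ∣?_) ∩? C?) n + count (∁? (G ∣?_) ∩? C?) n ∸ count ((G ∣?_) ∩? C?) n
  ≡⟨ cong₂ _∸_ (count-split (G ∣?_) C? n) (sym coprime-multiples) ⟨
    count C? n ∸ φ m
  ≡⟨ cong (_∸ φ m) coprime-all ⟩
    G * φ m ∸ φ m ∎
  where
  n = m * G
  C? : Decidable (λ u → Coprime u m)
  C? u = coprime? u m
  above⇒coprime : ∀ {u} → Above n G u → ¬ G ∣ u × Coprime u m
  above⇒coprime {u} (G∤u , gcd∣G) = G∤u , λ (i∣u , i∣m) →
    G⊥m (∣-trans (gcd-greatest i∣u (∣m⇒∣m*n G i∣m)) gcd∣G , i∣m)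
  -- the units modulo m repeat with period m
  coprime-all : count C? (m * G) ≡ G * φ m
  coprime-all = begin-equality
    count C? (m * G)   ≡⟨ cong (count C?) (*-comm m G) ⟩
    count C? (G * m)   ≡⟨ count-periodic C? m G (λ u → mk⇔ (coprime-+⁻ {u}) Coprimality.coprime-+) ⟩
    G * count C? m     ≡⟨ cong (G *_) (φ-count m) ⟨
    G * φ m            ∎
    where
    coprime-+⁻ : ∀ {u} → Coprime (m + u) m → Coprime u m
    coprime-+⁻ c (i∣u , i∣m) = c (∣m∣n⇒∣m+n i∣m i∣u , i∣m)
  -- the multiples t·G coprime to m correspond to the t < m coprime to m
  coprime-multiples : count ((G ∣?_) ∩? C?) (m * G) ≡ φ m
  coprime-multiples = begin-equality
    count ((G ∣?_) ∩? C?) (m * G)          ≡⟨ count-multiples C? G m ⟩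
    count (λ t → coprime? (t * G) m) m     ≡⟨ count-cong _ C? m (λ _ → coprime-*ʳ G⊥m) ⟩
    count C? m                             ≡⟨ φ-count m ⟨
    φ m                                    ∎

coprime-avoiding : ∀ {P Q u n} → Prime P → Prime Q →
                   gcd u n ∣ P * Q → ¬ P ∣ u → ¬ Q ∣ u → Coprime u n
coprime-avoiding {P} {Q} {u} {n} pP pQ gcd∣PQ P∤u Q∤u {i} (i∣u , i∣n) = Q⊥i (i∣Q , ∣-refl)
  where
  i⊥P : Coprime i P
  i⊥P = Coprimality.sym (prime∤⇒coprime pP (λ P∣i → P∤u (∣-trans P∣i i∣u)))
  i∣Q : i ∣ Q
  i∣Q = coprime-divisor i⊥P (∣-trans (gcd-greatest i∣u i∣n) gcd∣PQ)
  Q⊥i : Coprime Q i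
  Q⊥i = prime∤⇒coprime pQ (λ Q∣i → Q∤u (∣-trans Q∣i i∣u))

cofactor-coprime : ∀ {P Q u n k} .{{_ : NonZero P}} → Prime Q → P ∣ u → n ≡ k * P →
                   gcd u n ∣ P * Q → ¬ Q ∣ u → Coprime (u / P) k
cofactor-coprime {P} {Q} {u} {n} {k} pQ P∣u n≡kP gcd∣PQ Q∤u {i} (i∣u/P , i∣k) = Q⊥i (i∣Q , ∣-refl)
  where
  iP∣u : i * P ∣ u
  iP∣u = subst (i * P ∣_) (m/n*n≡m P∣u) (*-monoˡ-∣ P i∣u/P)
  iP∣n : i * P ∣ n
  iP∣n = subst (i * P ∣_) (sym n≡kP) (*-monoˡ-∣ P i∣k)
  i∣Q : i ∣ Q
  i∣Q = *-cancelˡ-∣ P (subst (_∣ P * Q) (*-comm i P) (∣-trans (gcd-greatest iP∣u iP∣n) gcd∣PQ))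
  Q⊥i : Coprime Q i
  Q⊥i = prime∤⇒coprime pQ (λ Q∣i → Q∤u (∣-trans (∣-trans Q∣i (m∣m*n P)) iP∣u))

count-coprime-cofactor : ∀ P k .{{_ : NonZero P}} →
                         count ((P ∣?_) ∩? (λ u → coprime? (u / P) k)) (k * P) ≡ φ k
count-coprime-cofactor P k = begin-equality
    count ((P ∣?_) ∩? (λ u → coprime? (u / P) k)) (k * P)
  ≡⟨ count-multiples (λ u → coprime? (u / P) k) P k ⟩
    count (λ t → coprime? (t * P / P) k) k
  ≡⟨ count-cong _ (λ t → coprime? t k) k (λ {t} _ → ≡⇒⇔ (cong (λ x → Coprime x k) (m*n/n≡m t P))) ⟩
    count (λ t → coprime? t k) k
  ≡⟨ φ-count k ⟨
    φ k ∎
  where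
  ≡⇒⇔ : A ≡ B → A ⇔ B
  ≡⇒⇔ refl = mk⇔ id id

-- If n = kp·P = kq·Q for distinct primes P, Q, then each u above P·Q is a unit, or
-- u = Q·t with gcd(t, kq) = 1, or u = P·t with gcd(t, kp) = 1.
count-above-two-primes : ∀ {n P Q kp kq} → Prime P → Prime Q → P ≢ Q → n ≡ kp * P → n ≡ kq * Q →
                         count (above? n (P * Q)) n ≤ φ n + (φ kq + φ kp)
count-above-two-primes {n} {P} {Q} {kp} {kq} pP pQ P≢Q n≡kpP n≡kqQ = begin
    count (above? n (P * Q)) n
  ≤⟨ count-mono _ (U? ∪? (ZQ? ∪? ZP?)) n (λ _ → classify) ⟩
    count (U? ∪? (ZQ? ∪? ZP?)) n
  ≤⟨ count-∪ U? (ZQ? ∪? ZP?) n ⟩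
    count U? n + count (ZQ? ∪? ZP?) n
  ≤⟨ +-monoʳ-≤ (count U? n) (count-∪ ZQ? ZP? n) ⟩
    count U? n + (count ZQ? n + count ZP? n)
  ≡⟨ cong₂ _+_ (φ-count n) (cong₂ _+_ units-Q units-P) ⟨
    φ n + (φ kq + φ kp) ∎
  where
  instance
    P≢0 : NonZero P
    P≢0 = prime⇒nonZero pP
    Q≢0 : NonZero Q
    Q≢0 = prime⇒nonZero pQ
  U? : Decidable (λ u → Coprime u n)
  U? u = coprime? u n
  ZP? : Decidable (λ u → P ∣ u × Coprime (u / P) kp)
  ZP? = (P ∣?_) ∩? (λ u → coprime? (u / P) kp)
  ZQ? : Decidable (λ u → Q ∣ u × Coprime (u / Q) kq)
  ZQ? = (Q ∣?_) ∩? (λ u → coprime? (u / Q) kq)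
  units-P : φ kp ≡ count ZP? n
  units-P = sym (subst (λ N → count ZP? N ≡ φ kp) (sym n≡kpP) (count-coprime-cofactor P kp))
  units-Q : φ kq ≡ count ZQ? n
  units-Q = sym (subst (λ N → count ZQ? N ≡ φ kq) (sym n≡kqQ) (count-coprime-cofactor Q kq))
  classify : ∀ {u} → Above n (P * Q) u →
             Coprime u n ⊎ ((Q ∣ u × Coprime (u / Q) kq) ⊎ (P ∣ u × Coprime (u / P) kp))
  classify {u} (PQ∤u , gcd∣PQ) with P ∣? u | Q ∣? u
  ... | yes P∣u | yes Q∣u =
    contradiction (coprime-∣-* (distinct-primes-coprime pP pQ P≢Q) P∣u Q∣u) PQ∤u
  ... | yes P∣u | no Q∤u  = inj₂ (inj₂ (P∣u , cofactor-coprime pQ P∣u n≡kpP gcd∣PQ Q∤u))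
  ... | no P∤u  | yes Q∣u =
    inj₂ (inj₁ (Q∣u , cofactor-coprime pP Q∣u n≡kqQ (subst (gcd u n ∣_) (*-comm P Q) gcd∣PQ) P∤u))
  ... | no P∤u  | no Q∤u  = inj₁ (coprime-avoiding pP pQ gcd∣PQ P∤u Q∤u)

factor-pos : ∀ {n m g} → suc n ≡ m * g → 1 ≤ m
factor-pos {m = zero}  ()
factor-pos {m = suc _} _ = s≤s z≤n

minDegree-≤-unitary : ∀ {n m G} → suc n ≡ m * G → Coprime G m →
                      minDegree (suc n) ≤ suc n div G + (G ∸ 1) * φ (suc n div G) ∸ 1
minDegree-≤-unitary {n} {m} {zero} N≡m*0 _ = contradiction (trans N≡m*0 (*-zeroʳ m)) λ ()
minDegree-≤-unitary {n} {m} {G@(suc _)} N≡mG G⊥m = begin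
    minDegree (suc n)
  ≤⟨ minDegree-≤-divisor {n} {m} {G} N≡mG ⟩
    (m ∸ 1) + count (above? (suc n) G) (suc n)
  ≤⟨ +-monoʳ-≤ (m ∸ 1) (subst (λ N → count (above? N G) N ≤ G * φ m ∸ φ m) (sym N≡mG)
                                (count-above-unitary G⊥m)) ⟩
    (m ∸ 1) + (G * φ m ∸ φ m)
  ≡⟨ +-∸-comm (G * φ m ∸ φ m) (factor-pos {n} {m} {G} N≡mG) ⟨
    m + (G * φ m ∸ φ m) ∸ 1
  ≡⟨ cong (λ x → m + x ∸ 1) (trans (*-distribʳ-∸ (φ m) G 1) (cong (G * φ m ∸_) (*-identityˡ (φ m)))) ⟨
    m + (G ∸ 1) * φ m ∸ 1
  ≡⟨ cong (λ x → x + (G ∸ 1) * φ x ∸ 1) (div-exact {suc n} {m} {G} N≡mG) ⟨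
    suc n div G + (G ∸ 1) * φ (suc n div G) ∸ 1 ∎

minDegree-≤-two-primes : ∀ {n P Q} → Prime P → Prime Q → P ≢ Q → P ∣ suc n → Q ∣ suc n →
  minDegree (suc n) ≤ suc n div (P * Q) + φ (suc n) + φ (suc n div Q) + φ (suc n div P) ∸ 1
minDegree-≤-two-primes {n} {P} {Q} pP pQ P≢Q P∣N@(divides kp N≡kpP) Q∣N@(divides kq N≡kqQ)
  with divides k N≡kPQ ← coprime-∣-* (distinct-primes-coprime pP pQ P≢Q) P∣N Q∣N = begin
    minDegree (suc n)
  ≤⟨ minDegree-≤-divisor {n} {k} {P * Q} N≡kPQ ⟩
    (k ∸ 1) + count (above? (suc n) (P * Q)) (suc n)
  ≤⟨ +-monoʳ-≤ (k ∸ 1) (count-above-two-primes {suc n} {P} {Q} {kp} {kq} pP pQ P≢Q N≡kpP N≡kqQ) ⟩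
    (k ∸ 1) + (φ (suc n) + (φ kq + φ kp))
  ≡⟨ +-∸-comm (φ (suc n) + (φ kq + φ kp)) (factor-pos {n} {k} {P * Q} N≡kPQ) ⟨
    k + (φ (suc n) + (φ kq + φ kp)) ∸ 1
  ≡⟨ cong (_∸ 1) (reassociate k (φ (suc n)) (φ kq) (φ kp)) ⟩
    k + φ (suc n) + φ kq + φ kp ∸ 1
  ≡⟨ cong₂ (λ x y → x + φ (suc n) + φ y + φ kp ∸ 1)
           (div-exact {suc n} {k} {P * Q} N≡kPQ) (div-exact {suc n} {kq} {Q} N≡kqQ) ⟨
    suc n div (P * Q) + φ (suc n) + φ (suc n div Q) + φ kp ∸ 1
  ≡⟨ cong (λ x → suc n div (P * Q) + φ (suc n) + φ (suc n div Q) + φ x ∸ 1)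
          (div-exact {suc n} {kp} {P} N≡kpP) ⟨
    suc n div (P * Q) + φ (suc n) + φ (suc n div Q) + φ (suc n div P) ∸ 1 ∎
  where
  instance
    P≢0 : NonZero P
    P≢0 = prime⇒nonZero pP
    Q≢0 : NonZero Q
    Q≢0 = prime⇒nonZero pQ
    PQ≢0 : NonZero (P * Q)
    PQ≢0 = m*n≢0 P Q
  reassociate : ∀ a b c d → a + (b + (c + d)) ≡ a + b + c + d
  reassociate = solve-∀

∣-^ : ∀ {q a} → 1 ≤ a → q ∣ q ^ a
∣-^ {q} {suc a} _ = m∣m*n (q ^ a)

-- The shape of n yields a unitary divisor q^α (as q^{α+1} ∤ n) and two distinct primes p < q.
upper-bounds : ∀ {n p q a} → Shape n p q a → minDegree n ≤ η₁ n q a × minDegree n ≤ η₂ n p q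
upper-bounds {zero} s = contradiction (Shape.n-pos s) λ ()
upper-bounds {suc n} {p} {q} {a} s with Shape.qᵃ∣n s
... | divides m N≡mqᵃ =
  minDegree-≤-unitary N≡mqᵃ (coprime-^ a (prime∤⇒coprime q-prime q∤m)) ,
  minDegree-≤-two-primes p-prime q-prime (<⇒≢ p<q) p∣n (∣-trans (∣-^ a-pos) qᵃ∣n)
  where
  open Shape s
  q∤m : ¬ q ∣ m
  q∤m (divides c m≡cq) =
    qᵃ⁺¹∤n (divides c (trans N≡mqᵃ (trans (cong (_* q ^ a) m≡cq) (*-assoc c q (q ^ a)))))

for-divisors : ∀ N .{{_ : NonZero N}} {R : Pred ℕ 0ℓ} (R? : Decidable R) →
               True (allUpTo? (λ d → d ∣? N →-dec R? d) (suc N)) → ∀ {d} → d ∣ N → R d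
for-divisors N R? ok d∣N = toWitness ok (s≤s (∣⇒≤ d∣N)) d∣N

shape6 : Shape 6 2 3 1
shape6 = record
  { n-pos     = z<s
  ; p-prime   = from-yes (prime? 2)
  ; q-prime   = from-yes (prime? 3)
  ; p<q       = from-yes (2 <? 3)
  ; p∣n       = divides 3 refl
  ; a-pos     = s≤s z≤n
  ; qᵃ∣n      = divides 2 refl
  ; qᵃ⁺¹∤n    = from-no (9 ∣? 6)
  ; q-largest = λ d d-prime d∣n → for-divisors 6 (λ d → prime? d →-dec d ≤? 3) tt d∣n d-prime
  ; p-next    = λ d d-prime d∣n → for-divisors 6 (λ d → prime? d →-dec d <? 3 →-dec d ≤? 2) tt d∣n d-prime
  }

shape210 : Shape 210 5 7 1
shape210 = record
  { n-pos     = z<s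
  ; p-prime   = from-yes (prime? 5)
  ; q-prime   = from-yes (prime? 7)
  ; p<q       = from-yes (5 <? 7)
  ; p∣n       = divides 42 refl
  ; a-pos     = s≤s z≤n
  ; qᵃ∣n      = divides 30 refl
  ; qᵃ⁺¹∤n    = from-no (49 ∣? 210)
  ; q-largest = λ d d-prime d∣n → for-divisors 210 (λ d → prime? d →-dec d ≤? 7) tt d∣n d-prime
  ; p-next    = λ d d-prime d∣n → for-divisors 210 (λ d → prime? d →-dec d <? 7 →-dec d ≤? 5) tt d∣n d-prime
  }

minDegree210 : minDegree 210 ≡ 73
minDegree210 = trans (minDegree≡ 210) refl

η₂210 : η₂ 210 5 7 ≡ 73
η₂210 = refl

proposition4p8 : ((n p q a : ℕ) → Shape n p q a → (minDegree n ≤ η₁ n q a) × (minDegree n ≤ η₂ n p q))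
    × (∃[ n ] ∃[ p ] ∃[ q ] ∃[ a ] (Shape n p q a × minDegree n ≡ η₁ n q a))
    × (∃[ n ] ∃[ p ] ∃[ q ] ∃[ a ] (Shape n p q a × minDegree n ≡ η₂ n p q))
proposition4p8 =
  (λ _ _ _ _ → upper-bounds) ,
  (6 , 2 , 3 , 1 , shape6 , refl) ,
  (210 , 5 , 7 , 1 , shape210 , trans minDegree210 (sym η₂210))
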